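{- For any well quasi-ordered posets $P_0,P_1,\dots,P_n$ (with $n<\omega$), $\mathbf{w}\bigl(\prod_{i\le n}P_i\bigr)\ge\mathbf{w}\bigl(\prod_{i\le n}\mathbf{h}(P_i)\bigr)$.
   Context: Products carry the componentwise (product) order; each ordinal $\mathbf{h}(P_i)$ is regarded as a linear order. For a tree of non-empty finite sequences ordered by strict initial segment $\sqsubset$ with no infinite branch, its rank is the least ordinal $\gamma$ admitting $f$ into $\gamma$ with $s\sqsubset t\implies f(s)>f(t)$. $\mathbf{h}(P)$ is the rank of the tree of non-empty strictly decreasing sequences of $P$; $\mathbf{w}(P)$ is the rank of the tree of non-empty sequences of pairwise incomparable elements of $P$. A well quasi-order is a quasi-order with no infinite strictly decreasing sequences and no infinite antichains. -}

module Defs where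

open import Level using (Level; _⊔_; Lift; lift; lower) renaming (suc to lsuc)
open import Data.Nat using (ℕ; suc)
open import Data.Fin using (Fin)
open import Data.List using (List; []; _∷_; _++_)
open import Data.List.Relation.Unary.Linked using (Linked)
open import Data.List.Relation.Unary.AllPairs using (AllPairs)
open import Data.Product using (Σ; _×_; ∃)
open import Relation.Nullary using (¬_)
open import Relation.Binary.PropositionalEquality using (_≡_; _≢_)
open import Relation.Binary.Bundles using (Poset)

data Ord (κ : Level) : Set (lsuc κ) where
  ozero : Ord κ
  osuc  : Ord κ → Ord κ
  osup  : (I : Set κ) → (I → Ord κ) → Ord κ

infix 4 _≤o_ _<o_

data _≤o_ {κ : Level} : Ord κ → Ord κ → Set (lsuc κ) where
  z≤o   : ∀ {β} → ozero ≤o β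
  s≤o   : ∀ {α β} → α ≤o β → osuc α ≤o osuc β
  ≤osup : ∀ {α I f} (i : I) → α ≤o f i → α ≤o osup I f
  osup≤ : ∀ {β I f} → (∀ (i : I) → f i ≤o β) → osup I f ≤o β

_<o_ : ∀ {κ} → Ord κ → Ord κ → Set (lsuc κ)
α <o β = osuc α ≤o β

liftOrd : ∀ {κ} κ' → Ord κ → Ord (κ ⊔ κ')
liftOrd κ' ozero      = ozero
liftOrd κ' (osuc α)   = osuc (liftOrd κ' α)
liftOrd κ' (osup I f) = osup (Lift κ' I) (λ i → liftOrd κ' (f (lower i)))

record OrdStr (a r : Level) : Set (lsuc (a ⊔ r)) where
  field
    Carrier : Set a
    _≼_     : Carrier → Carrier → Set r

module _ {a r} (P : OrdStr a r) where
  open OrdStr P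

  _≺_ : Carrier → Carrier → Set r
  x ≺ y = x ≼ y × ¬ (y ≼ x)

  Incomp : Carrier → Carrier → Set r
  Incomp x y = ¬ (x ≼ y) × ¬ (y ≼ x)

  IsWQO : Set (a ⊔ r)
  IsWQO = ¬ (Σ (ℕ → Carrier) λ f → ∀ n → f (suc n) ≺ f n)
        × ¬ (Σ (ℕ → Carrier) λ f → ∀ i j → i ≢ j → Incomp (f i) (f j))

  DecSeq : List Carrier → Set (a ⊔ r)
  DecSeq s = (s ≢ []) × Linked (λ x y → y ≺ x) s

  AntiSeq : List Carrier → Set (a ⊔ r)
  AntiSeq s = (s ≢ []) × AllPairs Incomp s

_⊏_ : ∀ {a} {A : Set a} → List A → List A → Set a
s ⊏ t = ∃ λ u → (u ≢ []) × (t ≡ s ++ u)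

module _ {a t} {A : Set a} (T : List A → Set t) where

  Node : Set (a ⊔ t)
  Node = Σ (List A) T

  Admits : ∀ {κ} → Ord κ → Set (a ⊔ t ⊔ lsuc κ)
  Admits {κ} γ = Σ (Node → Ord κ) λ f →
      (∀ (s : Node) → f s <o γ)
    × (∀ (s u : Node) → Σ.proj₁ s ⊏ Σ.proj₁ u → f u <o f s)

  IsRank : ∀ {κ} → Ord κ → Set (a ⊔ t ⊔ lsuc κ)
  IsRank {κ} γ = Admits γ × (∀ (γ' : Ord κ) → Admits γ' → γ ≤o γ')

IsHeight : ∀ {a r κ} (P : OrdStr a r) → Ord κ → Set (a ⊔ r ⊔ lsuc κ)
IsHeight P γ = IsRank (DecSeq P) γ

IsWidth : ∀ {a r κ} (P : OrdStr a r) → Ord κ → Set (a ⊔ r ⊔ lsuc κ)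
IsWidth P γ = IsRank (AntiSeq P) γ

posetStr : ∀ {c ℓ₁ ℓ₂} → Poset c ℓ₁ ℓ₂ → OrdStr c ℓ₂
posetStr P = record { Carrier = Poset.Carrier P ; _≼_ = Poset._≤_ P }

-- the ordinal γ regarded as the linear order of ordinals below γ
ordStr : ∀ {κ} → Ord κ → OrdStr (lsuc κ) (lsuc κ)
ordStr {κ} γ = record { Carrier = Σ (Ord κ) (λ β → β <o γ)
                      ; _≼_ = λ x y → Σ.proj₁ x ≤o Σ.proj₁ y }

Π : ∀ {a r} {n : ℕ} → (Fin (suc n) → OrdStr a r) → OrdStr a r
Π P = record { Carrier = ∀ i → OrdStr.Carrier (P i)
             ; _≼_ = λ x y → ∀ i → OrdStr._≼_ (P i) (x i) (y i) }

-- For each factor there is an order-REFLECTING map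
-- σ_i : h(P_i) → P_i  (σ(γ) ≤ σ(γ') ⇒ γ ≤ γ'): send γ < h(P_i) to an element
-- of height γ (heights of a WQO fill out all of h(P_i), classically).  The product map σ = ∏ σ_i again reflects the
-- order, so it sends antichains of ∏ h(P_i) to antichains of ∏ P_i and
-- preserves strict extension of sequences.  Composing a rank function of the
-- antichain tree of ∏ P_i with σ therefore ranks the antichain tree of
-- ∏ h(P_i), and minimality of the width gives the inequality.
module Submission where

open import Defs
open import Level using (Level; _⊔_; Lift; lift; lower) renaming (suc to lsuc)
open import Data.Nat using (ℕ; suc; zero)
open import Data.Fin using (Fin)
open import Relation.Binary.Bundles using (Poset)
open import Axiom.ExcludedMiddle using (ExcludedMiddle)
open import Axiom.DoubleNegationElimination using (em⇒dne)
open import Function using (_∘_)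
open import Data.Product using (Σ; _×_; _,_; proj₁; proj₂)
open import Data.Sum using (_⊎_; inj₁; inj₂)
open import Data.Empty using (⊥-elim)
open import Relation.Nullary using (¬_; yes; no)
open import Relation.Nullary.Decidable using (map′)
open import Relation.Binary.PropositionalEquality using (refl; _≢_)
open import Data.List using (List; []; _∷_; _++_; map)
open import Data.List.Properties using (map-++)
open import Data.List.Relation.Unary.Linked using (Linked; _∷_)
import Data.List.Relation.Unary.AllPairs as AllPairs
open import Data.List.Relation.Unary.AllPairs.Properties using (map⁺)
open import Induction.WellFounded using (Acc; acc; WellFounded)

em-lower : ∀ {ℓ} ℓ' → ExcludedMiddle (ℓ ⊔ ℓ') → ExcludedMiddle ℓ
em-lower ℓ' em = map′ (lower {ℓ = ℓ'}) lift em

module _ {κ : Level} where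

  ≤o-refl : (α : Ord κ) → α ≤o α
  ≤o-refl ozero      = z≤o
  ≤o-refl (osuc α)   = s≤o (≤o-refl α)
  ≤o-refl (osup I f) = osup≤ (λ i → ≤osup i (≤o-refl (f i)))

  ≤o-trans : {α β γ : Ord κ} → α ≤o β → β ≤o γ → α ≤o γ
  ≤o-trans z≤o         _           = z≤o
  ≤o-trans (s≤o p)     (s≤o q)     = s≤o (≤o-trans p q)
  ≤o-trans (s≤o p)     (≤osup j q) = ≤osup j (≤o-trans (s≤o p) q)
  ≤o-trans (≤osup i p) (≤osup j q) = ≤osup j (≤o-trans (≤osup i p) q)
  ≤o-trans (≤osup i p) (osup≤ g)   = ≤o-trans p (g i)
  ≤o-trans (osup≤ g)   q           = osup≤ (λ i → ≤o-trans (g i) q)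

  osuc-≤o-inv : {α β : Ord κ} → osuc α ≤o osuc β → α ≤o β
  osuc-≤o-inv (s≤o p) = p

  <o-osup-inv : {α : Ord κ} {I : Set κ} {f : I → Ord κ} →
                α <o osup I f → Σ I λ i → α <o f i
  <o-osup-inv (≤osup i p) = i , p

  ≤o-total : ExcludedMiddle (lsuc κ) → (α β : Ord κ) → α ≤o β ⊎ β <o α
  ≤o-total em ozero      β     = inj₁ z≤o
  ≤o-total em (osuc α)   ozero = inj₂ (s≤o z≤o)
  ≤o-total em (osuc α) (osuc β) with ≤o-total em α β
  ... | inj₁ p = inj₁ (s≤o p)
  ... | inj₂ q = inj₂ (s≤o q)
  ≤o-total em (osuc α) (osup J g) with em {Σ J λ j → osuc α ≤o g j}
  ... | yes (j , p) = inj₁ (≤osup j p)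
  ... | no ¬p = inj₂ (s≤o (osup≤ below))
    where
    below : ∀ j → g j ≤o α
    below j with ≤o-total em (osuc α) (g j)
    ... | inj₁ p = ⊥-elim (¬p (j , p))
    ... | inj₂ q = osuc-≤o-inv q
  ≤o-total em (osup I f) β with em {Σ I λ i → β <o f i}
  ... | yes (i , p) = inj₂ (≤osup i p)
  ... | no ¬p = inj₁ (osup≤ below)
    where
    below : ∀ i → f i ≤o β
    below i with ≤o-total em (f i) β
    ... | inj₁ p = p
    ... | inj₂ q = ⊥-elim (¬p (i , q))

liftOrd-mono : ∀ {κ} κ' {α β : Ord κ} → α ≤o β → liftOrd κ' α ≤o liftOrd κ' β
liftOrd-mono κ' z≤o         = z≤o
liftOrd-mono κ' (s≤o p)     = s≤o (liftOrd-mono κ' p)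
liftOrd-mono κ' (≤osup i p) = ≤osup (lift i) (liftOrd-mono κ' p)
liftOrd-mono κ' (osup≤ g)   = osup≤ (λ i → liftOrd-mono κ' (g (lower i)))

module _ {a b t u} {A : Set a} {B : Set b}
         {S : List A → Set t} {T : List B → Set u} where

  admits-pullback : (F : Node S → Node T) →
    (∀ s s' → proj₁ s ⊏ proj₁ s' → proj₁ (F s) ⊏ proj₁ (F s')) →
    ∀ {κ} {γ : Ord κ} → Admits T γ → Admits S γ
  admits-pullback F F-⊏ (f , bounded , decreasing) =
    f ∘ F , bounded ∘ F , λ s s' s⊏s' → decreasing (F s) (F s') (F-⊏ s s' s⊏s')

admits-lift : ∀ {a t κ} κ' {A : Set a} {T : List A → Set t} {γ : Ord κ} →
              Admits T γ → Admits T (liftOrd κ' γ)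
admits-lift κ' (f , bounded , decreasing) =
  liftOrd κ' ∘ f , liftOrd-mono κ' ∘ bounded ,
  λ s s' s⊏s' → liftOrd-mono κ' (decreasing s s' s⊏s')

module _ {a b} {A : Set a} {B : Set b} (f : A → B) where

  map-≢[] : {s : List A} → s ≢ [] → map f s ≢ []
  map-≢[] {[]}    s≢[] _ = s≢[] refl
  map-≢[] {_ ∷ _} _     ()

  map-⊏ : {s s' : List A} → s ⊏ s' → map f s ⊏ map f s'
  map-⊏ {s} (u , u≢[] , refl) = map f u , map-≢[] u≢[] , map-++ f s u

Reflects : ∀ {a r b s} (Q : OrdStr a r) (P : OrdStr b s) →
           (OrdStr.Carrier Q → OrdStr.Carrier P) → Set (a ⊔ r ⊔ s)
Reflects Q P m = ∀ x y → OrdStr._≼_ P (m x) (m y) → OrdStr._≼_ Q x y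

Π-reflects : ∀ {a r b s n} {Q : Fin (suc n) → OrdStr a r} {P : Fin (suc n) → OrdStr b s}
  (m : ∀ i → OrdStr.Carrier (Q i) → OrdStr.Carrier (P i)) →
  (∀ i → Reflects (Q i) (P i) (m i)) → Reflects (Π Q) (Π P) (λ x i → m i (x i))
Π-reflects m reflects x y mx≼my i = reflects i (x i) (y i) (mx≼my i)

module _ {a r b s} {Q : OrdStr a r} {P : OrdStr b s}
         (m : OrdStr.Carrier Q → OrdStr.Carrier P) (reflects : Reflects Q P m) where

  incomp-image : ∀ {x y} → Incomp Q x y → Incomp P (m x) (m y)
  incomp-image {x} {y} (x⋠y , y⋠x) = x⋠y ∘ reflects x y , y⋠x ∘ reflects y x

  width-reflect : ∀ {κ} {γ : Ord κ} → Admits (AntiSeq P) γ → Admits (AntiSeq Q) γ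
  width-reflect = admits-pullback image (λ _ _ → map-⊏ m)
    where
    image : Node (AntiSeq Q) → Node (AntiSeq P)
    image (s , s≢[] , antichain) =
      map m s , map-≢[] m s≢[] , map⁺ (AllPairs.map incomp-image antichain)

module _ {a r} {A : Set a} {_<_ : A → A → Set r} (em : ExcludedMiddle (a ⊔ r)) where

  private
    dne : {B : Set (a ⊔ r)} → ¬ ¬ B → B
    dne = em⇒dne em

    Inaccessible : Set (a ⊔ r)
    Inaccessible = Σ A λ x → ¬ Acc _<_ x

    descend : (x : Inaccessible) → Σ Inaccessible λ y → proj₁ y < proj₁ x
    descend (x , ¬acc-x) = dne λ ¬descend →
      ¬acc-x (acc λ {y} y<x → dne λ ¬acc-y → ¬descend ((y , ¬acc-y) , y<x))

    chain : Inaccessible → ℕ → Inaccessible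
    chain x zero    = x
    chain x (suc n) = proj₁ (descend (chain x n))

  -- Iterating the descent from an inaccessible element gives an infinite
  -- descending sequence.
  noDescent⇒wellFounded : ¬ (Σ (ℕ → A) λ f → ∀ n → f (suc n) < f n) → WellFounded _<_
  noDescent⇒wellFounded noDescent x = dne λ ¬acc-x →
    noDescent (proj₁ ∘ chain (x , ¬acc-x) , λ n → proj₂ (descend (chain (x , ¬acc-x) n)))

module Height {c ℓ₁ ℓ₂} (P : Poset c ℓ₁ ℓ₂) where
  open Poset P using (Carrier; _≤_) renaming (refl to ≤-refl; trans to ≤-trans)

  _<_ : Carrier → Carrier → Set ℓ₂
  _<_ = _≺_ (posetStr P)

  <-≤-trans : ∀ {x y z} → x < y → y ≤ z → x < z
  <-≤-trans (x≤y , y≰x) y≤z = ≤-trans x≤y y≤z , λ z≤x → y≰x (≤-trans y≤z z≤x)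

  <-trans : ∀ {x y z} → x < y → y < z → x < z
  <-trans x<y (y≤z , _) = <-≤-trans x<y y≤z

  last : Carrier → List Carrier → Carrier
  last x []       = x
  last x (y ∷ ys) = last y ys

  last-<-head : ∀ {x w ws} → Linked (λ u v → v < u) (x ∷ w ∷ ws) → last w ws < x
  last-<-head {ws = []}    (w<x ∷ _)        = w<x
  last-<-head {ws = _ ∷ _} (w<x ∷ decreasing) = <-trans (last-<-head decreasing) w<x

  last-<-extension : ∀ {x} xs {w ws} → Linked (λ u v → v < u) (x ∷ xs ++ w ∷ ws) →
                     last x (xs ++ w ∷ ws) < last x xs
  last-<-extension []       decreasing       = last-<-head decreasing
  last-<-extension (_ ∷ xs) (_ ∷ decreasing) = last-<-extension xs decreasing

  module _ (wf : WellFounded _<_) where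

    heightAcc : ∀ x → Acc _<_ x → Ord (c ⊔ ℓ₂)
    heightAcc x (acc rs) =
      osup (Σ Carrier (_< x)) λ (y , y<x) → osuc (heightAcc y (rs y<x))

    -- Monotone, and in particular independent of the accessibility proof.
    heightAcc-mono : ∀ {x y} (ax : Acc _<_ x) (ay : Acc _<_ y) → x ≤ y →
                     heightAcc x ax ≤o heightAcc y ay
    heightAcc-mono (acc rs) (acc rs') x≤y = osup≤ λ (z , z<x) →
      ≤osup (z , <-≤-trans z<x x≤y)
            (s≤o (heightAcc-mono (rs z<x) (rs' (<-≤-trans z<x x≤y)) ≤-refl))

    height : Carrier → Ord (c ⊔ ℓ₂)
    height x = heightAcc x (wf x)

    height-mono : ∀ {x y} → x ≤ y → height x ≤o height y
    height-mono = heightAcc-mono (wf _) (wf _)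

    height-strict : ∀ {x y} → x < y → height x <o height y
    height-strict {x} {y} x<y with wf y
    ... | acc rs = ≤osup (x , x<y) (s≤o (heightAcc-mono (wf x) (rs x<y) ≤-refl))

    height-pred : ∀ {γ x} → γ <o height x → Σ Carrier λ y → y < x × γ ≤o height y
    height-pred {x = x} γ<hx with wf x
    height-pred {x = x} (≤osup (y , y<x) γ<hy) | acc rs =
      y , y<x , ≤o-trans (osuc-≤o-inv γ<hy) (heightAcc-mono (rs y<x) (wf y) ≤-refl)

    height-attains : ExcludedMiddle (lsuc (c ⊔ ℓ₂)) → ∀ {γ} x → Acc _<_ x → γ ≤o height x →
                     Σ Carrier λ y → γ ≤o height y × height y ≤o γ
    height-attains em {γ} x (acc rs) γ≤hx with ≤o-total em (height x) γ
    ... | inj₁ hx≤γ = x , γ≤hx , hx≤γ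
    ... | inj₂ γ<hx with height-pred γ<hx
    ... | y , y<x , γ≤hy = height-attains em y (rs y<x) γ≤hy

    -- Every element's height is below this supremum …
    heightSup : Ord (c ⊔ ℓ₂)
    heightSup = osup (Lift ℓ₂ Carrier) λ x → osuc (height (lower x))

    -- … and ranking a decreasing sequence by the height of its last element
    -- shows that h(P) ≤ heightSup.
    decSeq-admits : Admits (DecSeq (posetStr P)) heightSup
    decSeq-admits = rank , bounded , decreasing
      where
      rank : Node (DecSeq (posetStr P)) → Ord (c ⊔ ℓ₂)
      rank ([]     , []≢[] , _) = ⊥-elim ([]≢[] refl)
      rank (x ∷ xs , _)         = height (last x xs)

      bounded : ∀ s → rank s <o heightSup
      bounded ([]     , []≢[] , _) = ⊥-elim ([]≢[] refl)
      bounded (x ∷ xs , _)         = ≤osup (lift (last x xs)) (≤o-refl _)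

      decreasing : ∀ s s' → proj₁ s ⊏ proj₁ s' → rank s' <o rank s
      decreasing ([] , []≢[] , _) _ _                           = ⊥-elim ([]≢[] refl)
      decreasing (x ∷ xs , _) _ ([] , []≢[] , _)                = ⊥-elim ([]≢[] refl)
      decreasing (x ∷ xs , _) (_ , _ , decSeq) (w ∷ ws , _ , refl) =
        height-strict (last-<-extension xs decSeq)

-- The section σ : h(P) → P choosing an element of each height; it reflects
-- the order because heights are monotone.
heightSection : ∀ {c ℓ₁ ℓ₂} (P : Poset c ℓ₁ ℓ₂) → ExcludedMiddle (lsuc (c ⊔ ℓ₂)) →
  IsWQO (posetStr P) → (h : Ord (c ⊔ ℓ₂)) → IsHeight (posetStr P) h →
  Σ (OrdStr.Carrier (ordStr h) → Poset.Carrier P) (Reflects (ordStr h) (posetStr P))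
heightSection {c} {ℓ₂ = ℓ₂} P em (noDescent , _) h isHeight = σ , reflects
  where
  open Height P
  wf : WellFounded _<_
  wf = noDescent⇒wellFounded (em-lower (lsuc (c ⊔ ℓ₂)) em) noDescent

  attains : ((γ , _) : OrdStr.Carrier (ordStr h)) →
            Σ (Poset.Carrier P) λ y → γ ≤o height wf y × height wf y ≤o γ
  attains (γ , γ<h) with <o-osup-inv (≤o-trans γ<h (proj₂ isHeight _ (decSeq-admits wf)))
  ... | x , γ<hx+1 = height-attains wf em (lower x) (wf (lower x)) (osuc-≤o-inv γ<hx+1)

  σ : OrdStr.Carrier (ordStr h) → Poset.Carrier P
  σ = proj₁ ∘ attains

  reflects : Reflects (ordStr h) (posetStr P) σ
  reflects γ γ' σγ≤σγ' = ≤o-trans (proj₁ (proj₂ (attains γ)))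
    (≤o-trans (height-mono wf σγ≤σγ') (proj₂ (proj₂ (attains γ'))))

theorem4p13 : ∀ {c ℓ₁ ℓ₂} → ExcludedMiddle (lsuc (lsuc (c ⊔ ℓ₁ ⊔ ℓ₂))) →
    (n : ℕ) (P : Fin (suc n) → Poset c ℓ₁ ℓ₂) →
    (∀ i → IsWQO (posetStr (P i))) →
    (h : Fin (suc n) → Ord (c ⊔ ℓ₂)) → (∀ i → IsHeight (posetStr (P i)) (h i)) →
    (α : Ord (c ⊔ ℓ₂)) → IsWidth (Π (λ i → posetStr (P i))) α →
    (β : Ord (lsuc (c ⊔ ℓ₂))) → IsWidth (Π (λ i → ordStr (h i))) β →
    β ≤o liftOrd (lsuc (c ⊔ ℓ₂)) α
theorem4p13 {c} {ℓ₁} {ℓ₂} em n P wqo h isHeight α (αAdmits , _) _ (_ , βMinimal) =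
  βMinimal (liftOrd κ α) (admits-lift κ (width-reflect σ productReflects αAdmits))
  where
  κ : Level
  κ = lsuc (c ⊔ ℓ₂)

  Q : Fin (suc n) → OrdStr κ κ
  Q i = ordStr (h i)

  P′ : Fin (suc n) → OrdStr c ℓ₂
  P′ i = posetStr (P i)

  section : ∀ i → Σ (OrdStr.Carrier (Q i) → OrdStr.Carrier (P′ i)) (Reflects (Q i) (P′ i))
  section i = heightSection (P i) (em-lower (lsuc (lsuc (c ⊔ ℓ₁ ⊔ ℓ₂))) em) (wqo i) (h i) (isHeight i)

  σ : OrdStr.Carrier (Π Q) → OrdStr.Carrier (Π P′)
  σ x i = proj₁ (section i) (x i)

  productReflects : Reflects (Π Q) (Π P′) σ
  productReflects = Π-reflects {Q = Q} {P = P′} (proj₁ ∘ section) (proj₂ ∘ section)
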